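{- Let $P$ be a finite graded poset of rank $n$ with $\hat0$ and $\hat1$ whose flag $h$-vector $\beta_P$ is multiplicity-free. Then $P$ has at most two elements of each rank.
   Context: For a finite graded poset $P$ of rank $n$ with $\hat0$ and $\hat1$ and rank function $\rho$, the flag $f$-vector is $\alpha_P(S)=$ number of chains $C$ of $P$ with $\{\rho(t):t\in C\}=S$, for $S\subseteq[n-1]$; the flag $h$-vector is $\beta_P(S)=\sum_{T\subseteq S}(-1)^{\#(S-T)}\alpha_P(T)$. $\beta_P$ is multiplicity-free if $\beta_P(S)\in\{0,1,-1\}$ for all $S\subseteq[n-1]$. -}

module Defs where

open import Data.Nat using (ℕ; zero; suc; _∸_; _≤_)
import Data.Nat as ℕ
open import Data.Bool using (Bool; true; false; _∧_; _∨_; not; if_then_else_)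
open import Data.Fin using (Fin; toℕ)
open import Data.Vec using (Vec; []; _∷_; lookup)
open import Data.List using (List; []; _∷_; [_]; map; _++_; filterᵇ; length; allFin; foldr)
open import Data.Bool.ListAction using (all; any)
open import Data.Integer using (ℤ; +_; -_; _+_; _*_)
open import Data.Product using (_×_)
open import Data.Sum using (_⊎_)
open import Relation.Nullary using (¬_)
open import Relation.Nullary.Decidable using (⌊_⌋)
open import Relation.Binary using (Rel; Decidable; IsPartialOrder)
open import Relation.Binary.PropositionalEquality using (_≡_)

Covers : ∀ {m} → Rel (Fin m) _ → Fin m → Fin m → Set
Covers _≼_ x y =
  x ≼ y × ¬ (x ≡ y) × (∀ z → x ≼ z → z ≼ y → z ≡ x ⊎ z ≡ y)

record GradedPoset (m n : ℕ) : Set₁ where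
  field
    _≼_       : Rel (Fin m) _
    isPO      : IsPartialOrder _≡_ _≼_
    _≼?_      : Decidable _≼_
    bot top   : Fin m
    bot-least : ∀ x → bot ≼ x
    top-great : ∀ x → x ≼ top
    ρ         : Fin m → ℕ
    ρ-bot     : ρ bot ≡ 0
    ρ-top     : ρ top ≡ n
    ρ-cover   : ∀ x y → Covers _≼_ x y → ρ y ≡ suc (ρ x)

allSubsets : (k : ℕ) → List (Vec Bool k)
allSubsets zero    = [ [] ]
allSubsets (suc k) = map (true ∷_) (allSubsets k) ++ map (false ∷_) (allSubsets k)

allᶠ : ∀ {k} → (Fin k → Bool) → Bool
allᶠ {k} p = all p (allFin k)

anyᶠ : ∀ {k} → (Fin k → Bool) → Bool
anyᶠ {k} p = any p (allFin k)

count : ∀ {A : Set} → (A → Bool) → List A → ℕ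
count p xs = length (filterᵇ p xs)

_⊆ᵇ_ : ∀ {k} → Vec Bool k → Vec Bool k → Bool
T ⊆ᵇ S = allᶠ (λ i → not (lookup T i) ∨ lookup S i)

diffSize : ∀ {k} → Vec Bool k → Vec Bool k → ℕ
diffSize {k} S T = count (λ i → lookup S i ∧ not (lookup T i)) (allFin k)

signPow : ℕ → ℤ
signPow zero    = + 1
signPow (suc k) = - signPow k

sumℤ : List ℤ → ℤ
sumℤ = foldr _+_ (+ 0)

module _ {m n : ℕ} (P : GradedPoset m n) where
  open GradedPoset P

  -- Subsets S ⊆ [n-1] are vectors of length n ∸ 1; index i stands for rank i+1.
  RankSet : Set
  RankSet = Vec Bool (n ∸ 1)

  isChain : Vec Bool m → Bool
  isChain C = allᶠ (λ x → allᶠ (λ y →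
    not (lookup C x ∧ lookup C y) ∨ (⌊ x ≼? y ⌋ ∨ ⌊ y ≼? x ⌋)))

  rankSetIs : Vec Bool m → RankSet → Bool
  rankSetIs C S =
    allᶠ (λ x → not (lookup C x) ∨ anyᶠ (λ i → lookup S i ∧ ⌊ ρ x ℕ.≟ suc (toℕ i) ⌋))
    ∧ allᶠ (λ i → not (lookup S i) ∨ anyᶠ (λ x → lookup C x ∧ ⌊ ρ x ℕ.≟ suc (toℕ i) ⌋))

  flagF : RankSet → ℕ
  flagF S = count (λ C → isChain C ∧ rankSetIs C S) (allSubsets m)

  flagH : RankSet → ℤ
  flagH S = sumℤ (map (λ T → signPow (diffSize S T) * + flagF T)
                      (filterᵇ (λ T → T ⊆ᵇ S) (allSubsets (n ∸ 1))))

  MultiplicityFree : Set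
  MultiplicityFree = ∀ (S : RankSet) → flagH S ≡ + 0 ⊎ flagH S ≡ + 1 ⊎ flagH S ≡ - (+ 1)

  rankCount : ℕ → ℕ
  rankCount k = count (λ x → ⌊ ρ x ℕ.≟ k ⌋) (allFin m)

-- For 0 < j < n the subsets of {j} are {j} and ∅, so β_P({j}) = α_P({j}) − α_P(∅).
-- The only chain with rank set ∅ is the empty one, so α_P(∅) = 1, and every element
-- of rank j is a chain with rank set {j}, so #(rank j) ≤ α_P({j}) = β_P({j}) + 1 ≤ 2.
-- The ranks 0 and ≥ n contain only 0̂ and 1̂ respectively, because ρ is strictly
-- monotone: every strict interval x < z contains an element covering x.
module Submission where

open import Defs
open import Data.Nat using (ℕ; _≤_; zero; suc; _∸_; _<_; z≤n; s≤s; _≤?_)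
import Data.Nat as ℕ
open import Data.Nat.Properties
  using ( module ≤-Reasoning; ∸-monoˡ-≤; ≤-trans; ≤-reflexive; ≤-antisym; <⇒≤; <⇒≱; ≰⇒>
        ; m≤n+m; +-mono-≤; n≤1+n)
open import Data.Bool using (Bool; true; false; T; T?; _∧_; _∨_; not; if_then_else_)
open import Data.Bool.Properties using (T-∧; T-∨; T-≡; ∧-inverseʳ)
open import Data.Bool.ListAction using (and)
open import Data.Fin using (Fin; toℕ; fromℕ<) renaming (zero to fzero; suc to fsuc)
open import Data.Fin.Properties using (any?; toℕ-fromℕ<) renaming (_≟_ to _≟ᶠ_)
open import Data.Fin.Induction using (po-wellFounded; po-noetherian)
open import Data.Fin.Subset using (⁅_⁆) renaming (⊥ to ∅)
open import Data.Fin.Subset.Properties using (x∈⁅x⁆; x∈⁅y⁆⇒x≡y; Empty-unique)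
open import Data.Vec using (Vec; []; _∷_; lookup)
open import Data.Vec.Properties using (∷-injectiveʳ; []=⇒lookup; lookup⇒[]=; lookup-replicate)
open import Data.List using (List; []; _∷_; [_]; map; _++_; filterᵇ; length; allFin)
open import Data.List.Properties
  using (map-tabulate; filter-++; filter-none; filter-≐; length-++; length-map)
open import Data.List.Membership.Propositional using (_∈_)
open import Data.List.Membership.Propositional.Properties
  using (∈-allFin; ∈-map⁺; ∈-map⁻; ∈-++⁺ˡ; ∈-++⁺ʳ; ∈-filter⁺; ∈-length)
open import Data.List.Relation.Unary.All as All using (All; []; _∷_)
open import Data.List.Relation.Unary.All.Properties using (all⁺; all⁻)
open import Data.List.Relation.Unary.Any as Any using ()
open import Data.List.Relation.Unary.Any.Properties using (any⁺; any⁻)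
open import Data.List.Relation.Binary.Disjoint.Propositional using (Disjoint)
open import Data.List.Relation.Unary.AllPairs using ([]; _∷_)
open import Data.List.Relation.Unary.Unique.Propositional using (Unique)
import Data.List.Relation.Unary.Unique.Propositional.Properties as Unique
open import Data.Integer using (ℤ; +_; -_; _+_; _-_; _*_)
import Data.Integer.Properties as ℤ
open import Data.Product using (_×_; _,_; proj₁; proj₂; ∃-syntax)
open import Data.Sum using (_⊎_; inj₁; inj₂)
open import Data.Unit using (tt)
open import Data.Empty using (⊥-elim)
open import Function using (_∘_; _⇔_; mk⇔; flip)
open import Function.Bundles using (module Equivalence)
open import Induction.WellFounded using (Acc; acc)
open import Relation.Binary using (IsPartialOrder)
open import Relation.Nullary using (¬_; yes; no)
open import Relation.Nullary.Decidable using (⌊_⌋; toWitness; fromWitness; _×-dec_; ¬?)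
open import Relation.Unary using (∁)
open import Relation.Binary.PropositionalEquality
  using (_≡_; _≢_; refl; sym; trans; cong; cong₂; subst; module ≡-Reasoning)

open Equivalence using (to; from)

T-not-∨ : ∀ {a b} → T (not a ∨ b) ⇔ (T a → T b)
T-not-∨ {true}  = mk⇔ (λ tb _ → tb) (λ f → f tt)
T-not-∨ {false} = mk⇔ (λ _ ()) (λ _ → tt)

module _ {k : ℕ} {p : Fin k → Bool} where

  allᶠ⁺ : (∀ x → T (p x)) → T (allᶠ p)
  allᶠ⁺ h = all⁻ p {allFin k} (All.tabulate λ {x} _ → h x)

  allᶠ⁻ : T (allᶠ p) → ∀ x → T (p x)
  allᶠ⁻ h x = All.lookup (all⁺ p (allFin k) h) (∈-allFin x)

  anyᶠ⁺ : ∀ x → T (p x) → T (anyᶠ p)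
  anyᶠ⁺ x px = any⁺ p (Any.map (λ { refl → px }) (∈-allFin x))

  anyᶠ⁻ : T (anyᶠ p) → ∃[ x ] T (p x)
  anyᶠ⁻ h = Any.satisfied (any⁻ p (allFin k) h)

allᶠ-suc : ∀ {k} (p : Fin (suc k) → Bool) → allᶠ p ≡ p fzero ∧ allᶠ (p ∘ fsuc)
allᶠ-suc {k} p = cong (p fzero ∧_) (cong and
  (trans (map-tabulate fsuc p) (sym (map-tabulate (λ x → x) (p ∘ fsuc)))))

module _ {A : Set} where

  filterᵇ-cong : ∀ {p q : A → Bool} → (∀ x → p x ≡ q x) → ∀ xs → filterᵇ p xs ≡ filterᵇ q xs
  filterᵇ-cong {p} {q} p≗q = filter-≐ (T? ∘ p) (T? ∘ q)
    ((λ {x} → subst T (p≗q x)) , (λ {x} → subst T (sym (p≗q x))))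

  filterᵇ-none : ∀ {p : A → Bool} {xs} → All (∁ (T ∘ p)) xs → filterᵇ p xs ≡ []
  filterᵇ-none {p} = filter-none (T? ∘ p)

  count-none : ∀ {p : A → Bool} {xs} → All (∁ (T ∘ p)) xs → count p xs ≡ 0
  count-none h = cong length (filterᵇ-none h)

  count-pos : ∀ {p : A → Bool} {x xs} → x ∈ xs → T (p x) → 1 ≤ count p xs
  count-pos {p} x∈xs px = ∈-length (∈-filter⁺ (T? ∘ p) x∈xs px)

  count-≤1 : ∀ {p : A → Bool} {v xs} → Unique xs → (∀ y → T (p y) → y ≡ v) → count p xs ≤ 1
  count-≤1 [] _ = z≤n
  count-≤1 {p} {xs = x ∷ xs} (x∉xs ∷ unique) only with p x in px
  ... | false = count-≤1 unique only
  ... | true  = s≤s (≤-reflexive (count-none (All.map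
    (λ {y} x≢y py → x≢y (trans (only x (from T-≡ px)) (sym (only y py)))) x∉xs)))

  count-++ : ∀ (p : A → Bool) xs ys → count p (xs ++ ys) ≡ count p xs ℕ.+ count p ys
  count-++ p xs ys = trans (cong length (filter-++ (T? ∘ p) xs ys)) (length-++ (filterᵇ p xs))

module _ {A B : Set} where

  filterᵇ-map : ∀ (p : B → Bool) (f : A → B) xs →
                filterᵇ p (map f xs) ≡ map f (filterᵇ (p ∘ f) xs)
  filterᵇ-map p f [] = refl
  filterᵇ-map p f (x ∷ xs) with p (f x)
  ... | true  = cong (f x ∷_) (filterᵇ-map p f xs)
  ... | false = filterᵇ-map p f xs

  count-map : ∀ (p : B → Bool) (f : A → B) xs → count p (map f xs) ≡ count (p ∘ f) xs
  count-map p f xs = trans (cong length (filterᵇ-map p f xs)) (length-map f (filterᵇ (p ∘ f) xs))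

∈-allSubsets : ∀ {k} (v : Vec Bool k) → v ∈ allSubsets k
∈-allSubsets []          = Any.here refl
∈-allSubsets (true ∷ v)  = ∈-++⁺ˡ (∈-map⁺ (true ∷_) (∈-allSubsets v))
∈-allSubsets {suc k} (false ∷ v) =
  ∈-++⁺ʳ (map (true ∷_) (allSubsets k)) (∈-map⁺ (false ∷_) (∈-allSubsets v))

allSubsets-unique : ∀ k → Unique (allSubsets k)
allSubsets-unique zero    = [] ∷ []
allSubsets-unique (suc k) = Unique.++⁺ (Unique.map⁺ ∷-injectiveʳ (allSubsets-unique k))
  (Unique.map⁺ ∷-injectiveʳ (allSubsets-unique k)) disjoint
  where
    disjoint : Disjoint (map (true ∷_) (allSubsets k)) (map (false ∷_) (allSubsets k))
    disjoint (t , f) with ∈-map⁻ (true ∷_) t | ∈-map⁻ (false ∷_) f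
    ... | _ , _ , refl | _ , _ , ()

count-allSubsets-suc : ∀ {k} (p : Vec Bool (suc k) → Bool) →
  count p (allSubsets (suc k)) ≡
  count (p ∘ (true ∷_)) (allSubsets k) ℕ.+ count (p ∘ (false ∷_)) (allSubsets k)
count-allSubsets-suc {k} p = trans (count-++ p (map (true ∷_) (allSubsets k)) _)
  (cong₂ ℕ._+_ (count-map p (true ∷_) (allSubsets k)) (count-map p (false ∷_) (allSubsets k)))

subsetsOf : ∀ {k} → Vec Bool k → List (Vec Bool k)
subsetsOf {k} v = filterᵇ (_⊆ᵇ v) (allSubsets k)

⊆ᵇ-∷ : ∀ {k} b c (u v : Vec Bool k) → (b ∷ u) ⊆ᵇ (c ∷ v) ≡ (not b ∨ c) ∧ (u ⊆ᵇ v)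
⊆ᵇ-∷ b c u v = allᶠ-suc (λ i → not (lookup (b ∷ u) i) ∨ lookup (c ∷ v) i)

subsetsOf-∷ : ∀ {k} c (v : Vec Bool k) →
  subsetsOf (c ∷ v) ≡ (if c then map (true ∷_) (subsetsOf v) else []) ++ map (false ∷_) (subsetsOf v)
subsetsOf-∷ {k} c v = begin
    filterᵇ (_⊆ᵇ (c ∷ v)) (map (true ∷_) subsets ++ map (false ∷_) subsets)
  ≡⟨ filter-++ (T? ∘ (_⊆ᵇ (c ∷ v))) (map (true ∷_) subsets) _ ⟩
    filterᵇ (_⊆ᵇ (c ∷ v)) (map (true ∷_) subsets) ++
    filterᵇ (_⊆ᵇ (c ∷ v)) (map (false ∷_) subsets)
  ≡⟨ cong₂ _++_ (filterᵇ-map (_⊆ᵇ (c ∷ v)) (true ∷_) subsets)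
                (filterᵇ-map (_⊆ᵇ (c ∷ v)) (false ∷_) subsets) ⟩
    map (true ∷_) (filterᵇ (λ u → (true ∷ u) ⊆ᵇ (c ∷ v)) subsets) ++
    map (false ∷_) (filterᵇ (λ u → (false ∷ u) ⊆ᵇ (c ∷ v)) subsets)
  ≡⟨ cong₂ (λ xs ys → map (true ∷_) xs ++ map (false ∷_) ys)
           (filterᵇ-cong (λ u → ⊆ᵇ-∷ true c u v) subsets)
           (filterᵇ-cong (λ u → ⊆ᵇ-∷ false c u v) subsets) ⟩
    map (true ∷_) (filterᵇ (λ u → c ∧ (u ⊆ᵇ v)) subsets) ++ map (false ∷_) (subsetsOf v)
  ≡⟨ cong (_++ map (false ∷_) (subsetsOf v)) (guarded c) ⟩
    (if c then map (true ∷_) (subsetsOf v) else []) ++ map (false ∷_) (subsetsOf v) ∎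
  where
    open ≡-Reasoning
    subsets = allSubsets k
    guarded : ∀ c → map (true ∷_) (filterᵇ (λ u → c ∧ (u ⊆ᵇ v)) subsets) ≡
                    (if c then map (true ∷_) (subsetsOf v) else [])
    guarded true  = refl
    guarded false = cong (map (true ∷_)) (filterᵇ-none (All.universal (λ _ ()) subsets))

subsetsOf-∅ : ∀ {k} → subsetsOf (∅ {k}) ≡ [ ∅ ]
subsetsOf-∅ {zero}  = refl
subsetsOf-∅ {suc k} = trans (subsetsOf-∷ false ∅) (cong (map (false ∷_)) subsetsOf-∅)

subsetsOf-⁅⁆ : ∀ {k} (j : Fin k) → subsetsOf ⁅ j ⁆ ≡ ⁅ j ⁆ ∷ ∅ ∷ []
subsetsOf-⁅⁆ fzero    =
  trans (subsetsOf-∷ true ∅) (cong (λ xs → map (true ∷_) xs ++ map (false ∷_) xs) subsetsOf-∅)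
subsetsOf-⁅⁆ (fsuc j) = trans (subsetsOf-∷ false ⁅ j ⁆) (cong (map (false ∷_)) (subsetsOf-⁅⁆ j))

T-lookup-⁅⁆ : ∀ {k} {i : Fin k} j → T (lookup ⁅ j ⁆ i) → i ≡ j
T-lookup-⁅⁆ {i = i} j h = x∈⁅y⁆⇒x≡y j (lookup⇒[]= i ⁅ j ⁆ (to T-≡ h))

T-lookup-⁅⁆-self : ∀ {k} (j : Fin k) → T (lookup ⁅ j ⁆ j)
T-lookup-⁅⁆-self j = from T-≡ ([]=⇒lookup (x∈⁅x⁆ j))

diffSize-self : ∀ {k} (v : Vec Bool k) → diffSize v v ≡ 0
diffSize-self {k} v = count-none (All.universal (λ i → subst T (∧-inverseʳ (lookup v i))) (allFin k))

diffSize-⁅⁆-∅ : ∀ {k} (j : Fin k) → diffSize ⁅ j ⁆ ∅ ≡ 1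
diffSize-⁅⁆-∅ {k} j = ≤-antisym
  (count-≤1 {v = j} (Unique.allFin⁺ k) λ i h →
    T-lookup-⁅⁆ j (proj₁ (to (T-∧ {lookup ⁅ j ⁆ i}) h)))
  (count-pos (∈-allFin j)
    (from T-∧ (T-lookup-⁅⁆-self j , subst (T ∘ not) (sym (lookup-replicate j false)) tt)))

count-≤-via-⁅⁆ : ∀ {k} {q : Fin k → Bool} {p : Vec Bool k → Bool} →
  (∀ x → T (q x) → T (p ⁅ x ⁆)) → count q (allFin k) ≤ count p (allSubsets k)
count-≤-via-⁅⁆ {zero} _ = z≤n
count-≤-via-⁅⁆ {suc k} {q} {p} h = begin
    count q (allFin (suc k))
  ≡⟨ cong (λ xs → count q (fzero ∷ xs)) (sym (map-tabulate (λ x → x) fsuc)) ⟩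
    count q (fzero ∷ map fsuc (allFin k))
  ≤⟨ split-first ⟩
    count (p ∘ (true ∷_)) (allSubsets k) ℕ.+ count (p ∘ (false ∷_)) (allSubsets k)
  ≡⟨ count-allSubsets-suc p ⟨
    count p (allSubsets (suc k)) ∎
  where
    open ≤-Reasoning
    rest : count q (map fsuc (allFin k)) ≤ count (p ∘ (false ∷_)) (allSubsets k)
    rest = ≤-trans (≤-reflexive (count-map q fsuc (allFin k))) (count-≤-via-⁅⁆ (λ x → h (fsuc x)))
    split-first : count q (fzero ∷ map fsuc (allFin k)) ≤
                  count (p ∘ (true ∷_)) (allSubsets k) ℕ.+ count (p ∘ (false ∷_)) (allSubsets k)
    split-first with q fzero in e
    ... | true  = +-mono-≤
      (count-pos {p = p ∘ (true ∷_)} (∈-allSubsets ∅) (h fzero (from T-≡ e))) rest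
    ... | false = ≤-trans rest (m≤n+m _ _)

≤2-of-unit-difference : ∀ {a b} → b ≤ 1 →
  (+ a - + b ≡ + 0 ⊎ + a - + b ≡ + 1 ⊎ + a - + b ≡ - (+ 1)) → a ≤ 2
≤2-of-unit-difference {0} _ _ = z≤n
≤2-of-unit-difference {1} _ _ = s≤s z≤n
≤2-of-unit-difference {2} _ _ = s≤s (s≤s z≤n)
≤2-of-unit-difference {suc (suc (suc _))} {0} _ (inj₁ ())
≤2-of-unit-difference {suc (suc (suc _))} {0} _ (inj₂ (inj₁ ()))
≤2-of-unit-difference {suc (suc (suc _))} {0} _ (inj₂ (inj₂ ()))
≤2-of-unit-difference {suc (suc (suc _))} {1} _ (inj₁ ())
≤2-of-unit-difference {suc (suc (suc _))} {1} _ (inj₂ (inj₁ ()))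
≤2-of-unit-difference {suc (suc (suc _))} {1} _ (inj₂ (inj₂ ()))
≤2-of-unit-difference {suc (suc (suc _))} {suc (suc _)} (s≤s ()) _

module _ {m n : ℕ} (P : GradedPoset m n) where
  open GradedPoset P
  private module ≼ = IsPartialOrder isPO

  _≺_ : Fin m → Fin m → Set
  x ≺ y = x ≼ y × x ≢ y

  cover-above : ∀ {x z} → Acc _≺_ z → x ≺ z → ∃[ c ] Covers _≼_ x c × c ≼ z
  cover-above {x} {z} (acc below) x≺z
    with any? (λ w → (x ≼? w ×-dec ¬? (x ≟ᶠ w)) ×-dec (w ≼? z ×-dec ¬? (w ≟ᶠ z)))
  ... | yes (w , x≺w , w≺z) =
    let c , x⋖c , c≼w = cover-above (below w≺z) x≺w in c , x⋖c , ≼.trans c≼w (proj₁ w≺z)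
  ... | no nothing-between = z , (proj₁ x≺z , proj₂ x≺z , endpoint) , ≼.refl
    where
      endpoint : ∀ w → x ≼ w → w ≼ z → w ≡ x ⊎ w ≡ z
      endpoint w x≼w w≼z with w ≟ᶠ x | w ≟ᶠ z
      ... | yes w≡x | _       = inj₁ w≡x
      ... | no _    | yes w≡z = inj₂ w≡z
      ... | no w≢x  | no w≢z  = ⊥-elim (nothing-between (w , (x≼w , w≢x ∘ sym) , (w≼z , w≢z)))

  ρ-strictMono : ∀ {x y} → Acc (flip _≺_) x → x ≺ y → ρ x < ρ y
  ρ-strictMono {x} {y} (acc above) x≺y with cover-above (po-wellFounded isPO y) x≺y
  ... | c , x⋖c , c≼y with c ≟ᶠ y
  ... | yes refl = ≤-reflexive (sym (ρ-cover x c x⋖c))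
  ... | no c≢y   = ≤-trans (≤-reflexive (sym (ρ-cover x c x⋖c)))
    (<⇒≤ (ρ-strictMono (above (proj₁ x⋖c , proj₁ (proj₂ x⋖c))) (c≼y , c≢y)))

  ρ≡0⇒≡bot : ∀ {x} → ρ x ≡ 0 → x ≡ bot
  ρ≡0⇒≡bot {x} ρx≡0 with x ≟ᶠ bot
  ... | yes x≡bot = x≡bot
  ... | no x≢bot  = ⊥-elim (<⇒≱ (ρ-strictMono (po-noetherian isPO bot) (bot-least x , x≢bot ∘ sym))
                                 (≤-reflexive (trans ρx≡0 (sym ρ-bot))))

  n≤ρ⇒≡top : ∀ {x} → n ≤ ρ x → x ≡ top
  n≤ρ⇒≡top {x} n≤ρx with x ≟ᶠ top
  ... | yes x≡top = x≡top
  ... | no x≢top  = ⊥-elim (<⇒≱ (ρ-strictMono (po-noetherian isPO x) (top-great x , x≢top))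
                                 (≤-trans (≤-reflexive ρ-top) n≤ρx))

  rankCount-0 : rankCount P 0 ≤ 1
  rankCount-0 = count-≤1 (Unique.allFin⁺ m) λ x h → ρ≡0⇒≡bot (toWitness h)

  rankCount-≥n : ∀ {k} → n ≤ k → rankCount P k ≤ 1
  rankCount-≥n n≤k = count-≤1 (Unique.allFin⁺ m) λ x h →
    n≤ρ⇒≡top (≤-trans n≤k (≤-reflexive (sym (toWitness h))))

  ⁅⁆-isChain : ∀ x → T (isChain P ⁅ x ⁆)
  ⁅⁆-isChain x = allᶠ⁺ λ y → allᶠ⁺ (comparable y)
    where
      ≡⇒comparable : ∀ {y z} → y ≡ z → T (⌊ y ≼? z ⌋ ∨ ⌊ z ≼? y ⌋)
      ≡⇒comparable {y} refl = from (T-∨ {⌊ y ≼? y ⌋}) (inj₁ (fromWitness ≼.refl))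
      comparable : ∀ y z →
        T (not (lookup ⁅ x ⁆ y ∧ lookup ⁅ x ⁆ z) ∨ (⌊ y ≼? z ⌋ ∨ ⌊ z ≼? y ⌋))
      comparable y z = from T-not-∨ λ h →
        let y∈ , z∈ = to (T-∧ {lookup ⁅ x ⁆ y}) h
        in ≡⇒comparable (trans (T-lookup-⁅⁆ x y∈) (sym (T-lookup-⁅⁆ x z∈)))

  ⁅⁆-rankSetIs : ∀ {x} {j : Fin (n ∸ 1)} → ρ x ≡ suc (toℕ j) → T (rankSetIs P ⁅ x ⁆ ⁅ j ⁆)
  ⁅⁆-rankSetIs {x} {j} ρx≡j = from T-∧ (allᶠ⁺ rank-in-⁅j⁆ , allᶠ⁺ rank-attained)
    where
      rank-in-⁅j⁆ : ∀ y →
        T (not (lookup ⁅ x ⁆ y) ∨ anyᶠ (λ i → lookup ⁅ j ⁆ i ∧ ⌊ ρ y ℕ.≟ suc (toℕ i) ⌋))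
      rank-in-⁅j⁆ y = from T-not-∨ λ y∈ → anyᶠ⁺ j
        (from T-∧ (T-lookup-⁅⁆-self j , fromWitness (trans (cong ρ (T-lookup-⁅⁆ x y∈)) ρx≡j)))
      rank-attained : ∀ i →
        T (not (lookup ⁅ j ⁆ i) ∨ anyᶠ (λ y → lookup ⁅ x ⁆ y ∧ ⌊ ρ y ℕ.≟ suc (toℕ i) ⌋))
      rank-attained i = from T-not-∨ λ i∈ → anyᶠ⁺ x (from T-∧ (T-lookup-⁅⁆-self x ,
        fromWitness (trans ρx≡j (cong (suc ∘ toℕ) (sym (T-lookup-⁅⁆ j i∈))))))

  rankCount≤flagF-⁅⁆ : ∀ j → rankCount P (suc (toℕ j)) ≤ flagF P ⁅ j ⁆
  rankCount≤flagF-⁅⁆ j = count-≤-via-⁅⁆ λ x h →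
    from T-∧ (⁅⁆-isChain x , ⁅⁆-rankSetIs (toWitness h))

  flagF-∅≤1 : flagF P ∅ ≤ 1
  flagF-∅≤1 = count-≤1 (allSubsets-unique m) λ C h → Empty-unique λ (x , x∈C) →
    let ranks-of-C = proj₁ (to T-∧ (proj₂ (to (T-∧ {isChain P C}) h)))
    in rank-in-∅ C x (allᶠ⁻ ranks-of-C x) (from T-≡ ([]=⇒lookup x∈C))
    where
      rank-in-∅ : ∀ C x →
        T (not (lookup C x) ∨ anyᶠ (λ i → lookup (∅ {n ∸ 1}) i ∧ ⌊ ρ x ℕ.≟ suc (toℕ i) ⌋)) →
        ¬ T (lookup C x)
      rank-in-∅ C x h x∈C with anyᶠ⁻ {n ∸ 1} (to (T-not-∨ {lookup C x}) h x∈C)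
      ... | i , i∈∅ = subst T (lookup-replicate i false) (proj₁ (to (T-∧ {lookup ∅ i}) i∈∅))

  flagH-⁅⁆ : ∀ j → flagH P ⁅ j ⁆ ≡ + flagF P ⁅ j ⁆ - + flagF P ∅
  flagH-⁅⁆ j = begin
      flagH P ⁅ j ⁆
    ≡⟨ cong (sumℤ ∘ map term) (subsetsOf-⁅⁆ j) ⟩
      term ⁅ j ⁆ + (term ∅ + + 0)
    ≡⟨ cong₂ (λ d e → signPow d * + flagF P ⁅ j ⁆ + (signPow e * + flagF P ∅ + + 0))
             (diffSize-self ⁅ j ⁆) (diffSize-⁅⁆-∅ j) ⟩
      + 1 * + flagF P ⁅ j ⁆ + (- + 1 * + flagF P ∅ + + 0)
    ≡⟨ cong₂ _+_ (ℤ.*-identityˡ (+ flagF P ⁅ j ⁆))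
                 (trans (ℤ.+-identityʳ _) (ℤ.-1*i≡-i (+ flagF P ∅))) ⟩
      + flagF P ⁅ j ⁆ - + flagF P ∅ ∎
    where
      open ≡-Reasoning
      term : RankSet P → ℤ
      term v = signPow (diffSize ⁅ j ⁆ v) * + flagF P v

  rankCount-interior : MultiplicityFree P → ∀ j → rankCount P (suc (toℕ j)) ≤ 2
  rankCount-interior mf j = ≤-trans (rankCount≤flagF-⁅⁆ j) (≤2-of-unit-difference flagF-∅≤1
    (subst (λ z → z ≡ + 0 ⊎ z ≡ + 1 ⊎ z ≡ - (+ 1)) (flagH-⁅⁆ j) (mf ⁅ j ⁆)))

lemma3p3 : ∀ {m n : ℕ} (P : GradedPoset m n) → MultiplicityFree P →
    ∀ (k : ℕ) → rankCount P k ≤ 2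
lemma3p3 P mf zero = ≤-trans (rankCount-0 P) (n≤1+n 1)
lemma3p3 {n = n} P mf (suc k) with n ≤? suc k
... | yes n≤1+k = ≤-trans (rankCount-≥n P n≤1+k) (n≤1+n 1)
... | no n≰1+k  =
  subst (λ i → rankCount P (suc i) ≤ 2) (toℕ-fromℕ< k<n-1) (rankCount-interior P mf (fromℕ< k<n-1))
  where
    k<n-1 : k < n ∸ 1
    k<n-1 = ∸-monoˡ-≤ 1 (≰⇒> n≰1+k)
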